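{- Let $\pi=a\alpha b\beta c$ be a permutation whose left to right maxima are exactly $a$, $b$ and $c$ (so $a$ is its first term and $c$ its last term), and suppose $\beta$ is non-empty. Then $B^{ -1}(\mathrm{Av}(\pi))=B^{ -1}(\mathrm{Av}(a\alpha b\beta))$, where $\mathrm{Av}(a\alpha b\beta)$ denotes $\mathrm{Av}$ of the permutation order isomorphic to the sequence $a\alpha b\beta$.
   Context: Permutations are sequences of length $n\ge1$ using each of $1,\ldots,n$ once. A left to right maximum of a sequence is a term larger than every term preceding it. For any finite sequence of distinct numbers, $B$ is defined recursively by $B(\epsilon)=\epsilon$ and, writing a non-empty sequence as $\sigma=\sigma_1 m\sigma_2$ with $m$ its largest term, $B(\sigma)=B(\sigma_1)\sigma_2 m$. $\mathrm{Av}(\pi)$ is the set of permutations having no (not necessarily consecutive) subsequence order isomorphic to $\pi$. $B^{ -1}(X)=\{\sigma:B(\sigma)\in X\}$. -}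

module Defs where

open import Data.Nat using (ℕ; zero; suc; _<_; _<ᵇ_; _≡ᵇ_; _⊔_)
open import Data.List using (List; []; _∷_; _++_; [_]; length; map; upTo; lookup; foldr)
open import Data.List.Relation.Binary.Permutation.Propositional using (_↭_)
open import Data.List.Relation.Binary.Sublist.Propositional using (_⊆_)
open import Data.Fin using (Fin; cast)
open import Data.Product using (Σ; ∃; _×_; _,_)
open import Data.Bool using (if_then_else_)
open import Relation.Nullary using (¬_)
open import Relation.Binary.PropositionalEquality using (_≡_)
open import Function.Bundles using (_⇔_)

IsPerm : List ℕ → Set
IsPerm xs = ¬ (xs ≡ []) × (xs ↭ map suc (upTo (length xs)))

OrderIso : List ℕ → List ℕ → Set
OrderIso xs ys = Σ (length xs ≡ length ys) λ e →
  ∀ (i j : Fin (length xs)) →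
    (lookup xs i < lookup xs j) ⇔ (lookup ys (cast e i) < lookup ys (cast e j))

Contains : List ℕ → List ℕ → Set
Contains σ π = ∃ λ τ → (τ ⊆ σ) × OrderIso τ π

Av : List ℕ → List ℕ → Set
Av π σ = IsPerm σ × ¬ Contains σ π

-- Left to right maxima (terms larger than all preceding terms); m = running max.
lrmaxFrom : ℕ → List ℕ → List ℕ
lrmaxFrom m [] = []
lrmaxFrom m (x ∷ xs) = if m <ᵇ x then x ∷ lrmaxFrom x xs else lrmaxFrom m xs

lrmax : List ℕ → List ℕ
lrmax [] = []
lrmax (x ∷ xs) = x ∷ lrmaxFrom x xs

maxOf : List ℕ → ℕ
maxOf = foldr _⊔_ 0

splitAt= : ℕ → List ℕ → List ℕ × List ℕ
splitAt= m [] = [] , []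
splitAt= m (x ∷ xs) with x ≡ᵇ m
... | Data.Bool.true = [] , xs
... | Data.Bool.false with splitAt= m xs
...   | (l , r) = (x ∷ l) , r

-- B with fuel; B(σ₁ m σ₂) = B(σ₁) σ₂ m, m the largest term.
Bfuel : ℕ → List ℕ → List ℕ
Bfuel zero σ = []
Bfuel (suc k) [] = []
Bfuel (suc k) (x ∷ xs) with splitAt= (maxOf (x ∷ xs)) (x ∷ xs)
... | (σ₁ , σ₂) = Bfuel k σ₁ ++ σ₂ ++ [ maxOf (x ∷ xs) ]

-- fuel = length σ suffices, since |σ₁| < |σ|
B : List ℕ → List ℕ
B σ = Bfuel (length σ) σ

-- Write π = π₀ z c. As c is the last left to right maximum of π it exceeds every other
-- term, and as z is not a left to right maximum some term of π₀ exceeds z. Now B σ ends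
-- with its largest term M. An occurrence of π₀ z in B σ cannot use M, since M would have
-- to play z, which lies below an earlier term of the pattern; so the occurrence lies
-- before M, and appending M extends it to an occurrence of π₀ z c. Conversely, dropping
-- the last term of an occurrence of π₀ z c leaves one of π₀ z. So B σ avoids π exactly
-- when it avoids π₀ z, which is order isomorphic to π′.
module Submission where

open import Defs
open import Data.Nat using (ℕ; zero; suc; _<_; _≤_; _<ᵇ_; _≡ᵇ_; z≤n)
open import Data.Nat.Properties
  using (suc-injective; 0≢1+n; <-irrefl; <-asym; <-trans; ≤-<-trans; ≤-refl; ≮⇒≥;
         ≤∧≢⇒<; ⊔-lub; m⊔n≤o⇒m≤o; m⊔n≤o⇒n≤o; <ᵇ-reflects-<)
open import Data.List using (List; []; _∷_; _++_; [_]; _∷ʳ_; length; zip; lookup; initLast; _∷ʳ′_)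
open import Data.List.Properties using (++-assoc; foldr-forcesᵇ; foldr-preservesᵇ)
open import Data.List.Membership.Propositional using (_∈_; _∉_)
open import Data.List.Membership.Propositional.Properties using (∈-++⁺ʳ)
open import Data.List.Relation.Unary.Any using (here; there)
open import Data.List.Relation.Unary.All as All using (All; []; _∷_)
import Data.List.Relation.Unary.All.Properties as All
open import Data.List.Relation.Unary.Unique.Propositional using (Unique; []; _∷_)
open import Data.List.Relation.Unary.Unique.Propositional.Properties using (map⁺; upTo⁺)
open import Data.List.Relation.Binary.Sublist.Propositional using (_⊆_; []; _∷_; ⊆-refl; ⊆-trans)
import Data.List.Relation.Binary.Sublist.Propositional as Sublist
open import Data.List.Relation.Binary.Sublist.Propositional.Properties using (++⁺; ++⁺ʳ; All-resp-⊆)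
open import Data.List.Relation.Binary.Permutation.Propositional using (↭-sym; ↭⇒↭ₛ)
import Data.List.Relation.Binary.Permutation.Setoid.Properties as Permutation
open import Data.Fin using (cast) renaming (zero to fzero; suc to fsuc)
open import Data.Product using (∃; ∃₂; _×_; _,_; proj₁; proj₂; map₂) renaming (map to map×)
open import Data.Sum using (_⊎_; inj₁; inj₂)
open import Data.Bool using (true; false)
open import Function using (_∘_; const; _⇔_; mk⇔; Equivalence)
import Function.Properties.Equivalence as ⇔
open import Relation.Nullary using (¬_; contradiction)
open import Relation.Nullary.Reflects using (ofʸ; ofⁿ)
open import Relation.Binary.PropositionalEquality using (_≡_; refl; sym; trans; cong; subst)
open import Relation.Binary.PropositionalEquality.Properties using (setoid)

private
  variable
    X Y Z : Set
    x y : X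
    xs ys as bs : List X

length-∷ʳ : ∀ (xs : List X) x → length (xs ∷ʳ x) ≡ suc (length xs)
length-∷ʳ []       x = refl
length-∷ʳ (_ ∷ xs) x = cong suc (length-∷ʳ xs x)

∉-Unique-++ : ∀ xs → Unique (xs ++ y ∷ ys) → y ∉ xs
∉-Unique-++ (x ∷ xs) (x≢ ∷ _) (here y≡x) = All.lookup x≢ (∈-++⁺ʳ xs (here refl)) (sym y≡x)
∉-Unique-++ (x ∷ xs) (_ ∷ unique) (there y∈xs) = ∉-Unique-++ xs unique y∈xs

IsPerm⇒Unique : ∀ {xs} → IsPerm xs → Unique xs
IsPerm⇒Unique {xs} (_ , xs↭) =
  Permutation.Unique-resp-↭ (setoid ℕ) (↭⇒↭ₛ (↭-sym xs↭)) (map⁺ suc-injective (upTo⁺ (length xs)))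

⊆-∷ʳ⁻ : ∀ ys → xs ⊆ ys ∷ʳ y → xs ⊆ ys ⊎ ∃ λ xs′ → xs ≡ xs′ ∷ʳ y × xs′ ⊆ ys
⊆-∷ʳ⁻ []       (_ Sublist.∷ʳ []) = inj₁ []
⊆-∷ʳ⁻ []       (refl ∷ [])       = inj₂ ([] , refl , [])
⊆-∷ʳ⁻ (y ∷ ys) (.y Sublist.∷ʳ sub) with ⊆-∷ʳ⁻ ys sub
... | inj₁ sub′               = inj₁ (y Sublist.∷ʳ sub′)
... | inj₂ (xs′ , refl , sub′) = inj₂ (xs′ , refl , y Sublist.∷ʳ sub′)
⊆-∷ʳ⁻ (y ∷ ys) (refl ∷ sub) with ⊆-∷ʳ⁻ ys sub
... | inj₁ sub′               = inj₁ (refl ∷ sub′)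
... | inj₂ (xs′ , refl , sub′) = inj₂ (y ∷ xs′ , refl , refl ∷ sub′)

∈-zip-lookup : ∀ (xs : List X) (ys : List Y) (e : length xs ≡ length ys) i →
  (lookup xs i , lookup ys (cast e i)) ∈ zip xs ys
∈-zip-lookup (x ∷ xs) (y ∷ ys) e fzero    = here refl
∈-zip-lookup (x ∷ xs) (y ∷ ys) e (fsuc i) = there (∈-zip-lookup xs ys (suc-injective e) i)

∈-zip⇒lookup : ∀ (xs : List X) (ys : List Y) (e : length xs ≡ length ys) → (x , y) ∈ zip xs ys →
  ∃ λ i → lookup xs i ≡ x × lookup ys (cast e i) ≡ y
∈-zip⇒lookup (x ∷ xs) (y ∷ ys) e (here refl) = fzero , refl , refl
∈-zip⇒lookup (x ∷ xs) (y ∷ ys) e (there p) with ∈-zip⇒lookup xs ys (suc-injective e) p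
... | i , xsᵢ≡x , ysᵢ≡y = fsuc i , xsᵢ≡x , ysᵢ≡y

∈-zip-swap : ∀ (xs : List X) (ys : List Y) → (x , y) ∈ zip xs ys → (y , x) ∈ zip ys xs
∈-zip-swap (_ ∷ xs) (_ ∷ ys) (here refl) = here refl
∈-zip-swap (_ ∷ xs) (_ ∷ ys) (there p)   = there (∈-zip-swap xs ys p)

∈-zip-compose : ∀ (xs : List X) (ys : List Y) (zs : List Z) {z} → length xs ≡ length ys →
  (x , z) ∈ zip xs zs → ∃ λ y → (x , y) ∈ zip xs ys × (y , z) ∈ zip ys zs
∈-zip-compose (_ ∷ xs) (y ∷ ys) (_ ∷ zs) e (here refl) = y , here refl , here refl
∈-zip-compose (_ ∷ xs) (_ ∷ ys) (_ ∷ zs) e (there p) with ∈-zip-compose xs ys zs (suc-injective e) p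
... | y , p₁ , p₂ = y , there p₁ , there p₂

∈-zip⁻ : ∀ (xs : List X) (ys : List Y) → (x , y) ∈ zip xs ys → x ∈ xs × y ∈ ys
∈-zip⁻ (_ ∷ xs) (_ ∷ ys) (here refl) = here refl , here refl
∈-zip⁻ (_ ∷ xs) (_ ∷ ys) (there p)   = map× there there (∈-zip⁻ xs ys p)

∈-zip⁺ʳ : ∀ (xs : List X) (ys : List Y) → length xs ≡ length ys → y ∈ ys →
  ∃ λ x → (x , y) ∈ zip xs ys
∈-zip⁺ʳ (x ∷ xs) (_ ∷ ys) e (here refl) = x , here refl
∈-zip⁺ʳ (_ ∷ xs) (_ ∷ ys) e (there y∈) = map₂ there (∈-zip⁺ʳ xs ys (suc-injective e) y∈)

∈-zip-++⁺ˡ : ∀ (xs : List X) (ys : List Y) {p} → p ∈ zip xs ys → p ∈ zip (xs ++ as) (ys ++ bs)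
∈-zip-++⁺ˡ (_ ∷ xs) (_ ∷ ys) (here refl) = here refl
∈-zip-++⁺ˡ (_ ∷ xs) (_ ∷ ys) (there p)   = there (∈-zip-++⁺ˡ xs ys p)

∈-zip-∷ʳ⁺ : ∀ (xs : List X) (ys : List Y) → length xs ≡ length ys →
  (x , y) ∈ zip (xs ∷ʳ x) (ys ∷ʳ y)
∈-zip-∷ʳ⁺ []       []       e = here refl
∈-zip-∷ʳ⁺ (_ ∷ xs) (_ ∷ ys) e = there (∈-zip-∷ʳ⁺ xs ys (suc-injective e))

∈-zip-∷ʳ⁻ : ∀ (xs : List X) (ys : List Y) {p} → length xs ≡ length ys →
  p ∈ zip (xs ∷ʳ x) (ys ∷ʳ y) → p ∈ zip xs ys ⊎ p ≡ (x , y)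
∈-zip-∷ʳ⁻ []       []       e (here p≡) = inj₂ p≡
∈-zip-∷ʳ⁻ (_ ∷ xs) (_ ∷ ys) e (here p≡) = inj₁ (here p≡)
∈-zip-∷ʳ⁻ (_ ∷ xs) (_ ∷ ys) e (there p) with ∈-zip-∷ʳ⁻ xs ys (suc-injective e) p
... | inj₁ p′ = inj₁ (there p′)
... | inj₂ p≡ = inj₂ p≡

-- OrderIso read off the pairs of corresponding terms instead of through Fin indices.
record _≃_ (xs ys : List ℕ) : Set where
  constructor _,_
  field
    same-length : length xs ≡ length ys
    same-order  : ∀ {u v u′ v′} → (u , v) ∈ zip xs ys → (u′ , v′) ∈ zip xs ys → u < u′ ⇔ v < v′

OrderIso⇒≃ : ∀ xs ys → OrderIso xs ys → xs ≃ ys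
OrderIso⇒≃ xs ys (e , iso) = e , ≃-pairs
  where
  ≃-pairs : ∀ {u v u′ v′} → (u , v) ∈ zip xs ys → (u′ , v′) ∈ zip xs ys → u < u′ ⇔ v < v′
  ≃-pairs p q with ∈-zip⇒lookup xs ys e p | ∈-zip⇒lookup xs ys e q
  ... | i , refl , refl | j , refl , refl = iso i j

≃⇒OrderIso : ∀ {xs ys} → xs ≃ ys → OrderIso xs ys
≃⇒OrderIso {xs} {ys} (e , iso) = e , λ i j → iso (∈-zip-lookup xs ys e i) (∈-zip-lookup xs ys e j)

≃-sym : ∀ {xs ys} → xs ≃ ys → ys ≃ xs
≃-sym {xs} {ys} (e , iso) = sym e , λ p q → ⇔.sym (iso (∈-zip-swap ys xs p) (∈-zip-swap ys xs q))

≃-trans : ∀ {xs ys zs} → xs ≃ ys → ys ≃ zs → xs ≃ zs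
≃-trans {xs} {ys} {zs} (e₁ , iso₁) (e₂ , iso₂) = trans e₁ e₂ , ≃-pairs
  where
  ≃-pairs : ∀ {u w u′ w′} → (u , w) ∈ zip xs zs → (u′ , w′) ∈ zip xs zs → u < u′ ⇔ w < w′
  ≃-pairs p q with ∈-zip-compose xs ys zs e₁ p | ∈-zip-compose xs ys zs e₁ q
  ... | _ , p₁ , p₂ | _ , q₁ , q₂ = ⇔.trans (iso₁ p₁ q₁) (iso₂ p₂ q₂)

≃-∷ʳ⁻ : ∀ {xs ys x y} → (xs ∷ʳ x) ≃ (ys ∷ʳ y) → xs ≃ ys
≃-∷ʳ⁻ {xs} {ys} {x} {y} (e , iso) = e′ , λ p q → iso (∈-zip-++⁺ˡ xs ys p) (∈-zip-++⁺ˡ xs ys q)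
  where
  e′ : length xs ≡ length ys
  e′ = suc-injective (trans (sym (length-∷ʳ xs x)) (trans e (length-∷ʳ ys y)))

≃-∷ʳ⁺ : ∀ {xs ys x y} → xs ≃ ys → All (_< x) xs → All (_< y) ys → (xs ∷ʳ x) ≃ (ys ∷ʳ y)
≃-∷ʳ⁺ {xs} {ys} {x} {y} (e , iso) xs<x ys<y =
  trans (length-∷ʳ xs x) (trans (cong suc e) (sym (length-∷ʳ ys y))) ,
  λ p q → compare (∈-zip-∷ʳ⁻ xs ys e p) (∈-zip-∷ʳ⁻ xs ys e q)
  where
  below : ∀ {u v} → (u , v) ∈ zip xs ys → u < x × v < y
  below p with ∈-zip⁻ xs ys p
  ... | u∈ , v∈ = All.lookup xs<x u∈ , All.lookup ys<y v∈
  compare : ∀ {u v u′ v′} → (u , v) ∈ zip xs ys ⊎ (u , v) ≡ (x , y) →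
    (u′ , v′) ∈ zip xs ys ⊎ (u′ , v′) ≡ (x , y) → u < u′ ⇔ v < v′
  compare (inj₁ p) (inj₁ q) = iso p q
  compare (inj₁ p) (inj₂ refl) with below p
  ... | u<x , v<y = mk⇔ (const v<y) (const u<x)
  compare (inj₂ refl) (inj₁ q) with below q
  ... | u<x , v<y =
    mk⇔ (λ x<u → contradiction u<x (<-asym x<u)) (λ y<v → contradiction v<y (<-asym y<v))
  compare (inj₂ refl) (inj₂ refl) =
    mk⇔ (λ x<x → contradiction x<x (<-irrefl refl)) (λ y<y → contradiction y<y (<-irrefl refl))

≃-∷ʳ-All< : ∀ {xs ys x y} → (xs ∷ʳ x) ≃ (ys ∷ʳ y) → All (_< x) xs → All (_< y) ys
≃-∷ʳ-All< {xs} {ys} {x} {y} xx≃yy@(_ , iso) xs<x = All.tabulate y>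
  where
  e : length xs ≡ length ys
  e = _≃_.same-length (≃-∷ʳ⁻ xx≃yy)
  y> : ∀ {v} → v ∈ ys → v < y
  y> v∈ with ∈-zip⁺ʳ xs ys e v∈
  ... | u , uv∈ = Equivalence.to (iso (∈-zip-++⁺ˡ xs ys uv∈) (∈-zip-∷ʳ⁺ xs ys e))
                    (All.lookup xs<x (proj₁ (∈-zip⁻ xs ys uv∈)))

Contains-resp-≃ : ∀ {σ π π′} → π ≃ π′ → Contains σ π → Contains σ π′
Contains-resp-≃ π≃π′ (τ , τ⊆σ , τ≅π) = τ , τ⊆σ , ≃⇒OrderIso (≃-trans (OrderIso⇒≃ τ _ τ≅π) π≃π′)

Contains-∷ʳ⁻ : ∀ {σ π c} → Contains σ (π ∷ʳ c) → Contains σ π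
Contains-∷ʳ⁻ {π = π} {c} (τ , τ⊆σ , τ≅πc) with initLast τ
... | [] = contradiction (trans (proj₁ τ≅πc) (length-∷ʳ π c)) 0≢1+n
... | τ′ ∷ʳ′ t =
  τ′ , ⊆-trans (++⁺ʳ [ t ] ⊆-refl) τ⊆σ , ≃⇒OrderIso (≃-∷ʳ⁻ (OrderIso⇒≃ (τ′ ∷ʳ t) (π ∷ʳ c) τ≅πc))

Contains-∷ʳ⁺ : ∀ {ρ π M c} → All (_< M) ρ → All (_< c) π → Contains ρ π → Contains (ρ ∷ʳ M) (π ∷ʳ c)
Contains-∷ʳ⁺ {π = π} ρ<M π<c (τ , τ⊆ρ , τ≅π) =
  _ , ++⁺ τ⊆ρ ⊆-refl , ≃⇒OrderIso (≃-∷ʳ⁺ (OrderIso⇒≃ τ π τ≅π) (All-resp-⊆ τ⊆ρ ρ<M) π<c)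

-- An occurrence of π z ending at the maximum M would force every term of π below z.
Contains-∷ʳ-max⁻ : ∀ {ρ π M z} → All (_< M) ρ → ¬ All (_< z) π →
  Contains (ρ ∷ʳ M) (π ∷ʳ z) → Contains ρ (π ∷ʳ z)
Contains-∷ʳ-max⁻ {ρ} {π} {M} {z} ρ<M π≮z (τ , τ⊆ρM , τ≅πz) with ⊆-∷ʳ⁻ ρ τ⊆ρM
... | inj₁ τ⊆ρ = τ , τ⊆ρ , τ≅πz
... | inj₂ (τ′ , refl , τ′⊆ρ) =
  contradiction (≃-∷ʳ-All< (OrderIso⇒≃ (τ′ ∷ʳ M) (π ∷ʳ z) τ≅πz) (All-resp-⊆ τ′⊆ρ ρ<M)) π≮z

Contains-∷ʳ-max⇔ : ∀ {ρ π M z c} → All (_< M) ρ → All (_< c) (π ∷ʳ z) → ¬ All (_< z) π →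
  Contains (ρ ∷ʳ M) (π ∷ʳ z ∷ʳ c) ⇔ Contains (ρ ∷ʳ M) (π ∷ʳ z)
Contains-∷ʳ-max⇔ {ρ} {π} {M} {z} {c} ρ<M πz<c π≮z =
  mk⇔ (Contains-∷ʳ⁻ {π = π ∷ʳ z} {c}) (Contains-∷ʳ⁺ ρ<M πz<c ∘ Contains-∷ʳ-max⁻ ρ<M π≮z)

Av-cong : ∀ {σ π π′} → (IsPerm σ → Contains σ π ⇔ Contains σ π′) → Av π σ ⇔ Av π′ σ
Av-cong C⇔C′ = mk⇔ (λ (perm , ∌π) → perm , ∌π ∘ Equivalence.from (C⇔C′ perm))
                   (λ (perm , ∌π′) → perm , ∌π′ ∘ Equivalence.to (C⇔C′ perm))

Av-resp-≃ : ∀ {σ π π′} → π ≃ π′ → Av π σ ⇔ Av π′ σ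
Av-resp-≃ {σ} {π} {π′} π≃π′ =
  Av-cong {σ} {π} {π′} λ _ → mk⇔ (Contains-resp-≃ π≃π′) (Contains-resp-≃ (≃-sym π≃π′))

lrmaxFrom-above : ∀ m xs → All (m <_) (lrmaxFrom m xs)
lrmaxFrom-above m [] = []
lrmaxFrom-above m (x ∷ xs) with m <ᵇ x | <ᵇ-reflects-< m x
... | true  | ofʸ m<x = m<x ∷ All.map (<-trans m<x) (lrmaxFrom-above x xs)
... | false | _       = lrmaxFrom-above m xs

∈-lrmaxFrom⁺ : ∀ {m y} xs ys → m < y → All (_< y) xs → y ∈ lrmaxFrom m (xs ++ y ∷ ys)
∈-lrmaxFrom⁺ {m} {y} [] ys m<y [] with m <ᵇ y | <ᵇ-reflects-< m y
... | true  | _        = here refl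
... | false | ofⁿ m≮y = contradiction m<y m≮y
∈-lrmaxFrom⁺ {m} (x ∷ xs) ys m<y (x<y ∷ xs<y) with m <ᵇ x
... | true  = there (∈-lrmaxFrom⁺ xs ys x<y xs<y)
... | false = ∈-lrmaxFrom⁺ xs ys m<y xs<y

∈-lrmaxFrom⁻ : ∀ {m y} xs ys → y ∉ xs → y ∈ lrmaxFrom m (xs ++ y ∷ ys) → m < y × All (_< y) xs
∈-lrmaxFrom⁻ {m} [] ys _ y∈ = All.lookup (lrmaxFrom-above m (_ ∷ ys)) y∈ , []
∈-lrmaxFrom⁻ {m} (x ∷ xs) ys y∉ y∈ with m <ᵇ x | <ᵇ-reflects-< m x
... | true | ofʸ m<x with y∈
...   | here y≡x  = contradiction (here y≡x) y∉
...   | there y∈′ with ∈-lrmaxFrom⁻ xs ys (y∉ ∘ there) y∈′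
...     | x<y , xs<y = <-trans m<x x<y , x<y ∷ xs<y
∈-lrmaxFrom⁻ {m} (x ∷ xs) ys y∉ y∈ | false | ofⁿ m≮x with ∈-lrmaxFrom⁻ xs ys (y∉ ∘ there) y∈
... | m<y , xs<y = m<y , ≤-<-trans (≮⇒≥ m≮x) m<y ∷ xs<y

All<⇒∈-lrmax : ∀ {y} xs ys → All (_< y) xs → y ∈ lrmax (xs ++ y ∷ ys)
All<⇒∈-lrmax []       ys []           = here refl
All<⇒∈-lrmax (x ∷ xs) ys (x<y ∷ xs<y) = there (∈-lrmaxFrom⁺ xs ys x<y xs<y)

∈-lrmax⇒All< : ∀ {y} xs ys → y ∉ xs → y ∈ lrmax (xs ++ y ∷ ys) → All (_< y) xs
∈-lrmax⇒All< []       ys _  _            = []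
∈-lrmax⇒All< (x ∷ xs) ys y∉ (here y≡x)   = contradiction (here y≡x) y∉
∈-lrmax⇒All< (x ∷ xs) ys y∉ (there y∈) with ∈-lrmaxFrom⁻ xs ys (y∉ ∘ there) y∈
... | x<y , xs<y = x<y ∷ xs<y

maxOf-upper : ∀ xs → All (_≤ maxOf xs) xs
maxOf-upper xs = foldr-forcesᵇ (λ m n m⊔n≤ → m⊔n≤o⇒m≤o m n m⊔n≤ , m⊔n≤o⇒n≤o m n m⊔n≤) 0 xs ≤-refl

maxOf-least : ∀ {n xs} → All (_≤ n) xs → maxOf xs ≤ n
maxOf-least = foldr-preservesᵇ ⊔-lub z≤n

splitAt=-All : ∀ {P : ℕ → Set} m {l} → All P l →
  All P (proj₁ (splitAt= m l)) × All P (proj₂ (splitAt= m l))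
splitAt=-All m [] = [] , []
splitAt=-All m {x ∷ xs} (px ∷ pxs) with x ≡ᵇ m
... | true  = [] , pxs
... | false with splitAt= m xs | splitAt=-All m pxs
...   | _ , _ | pl , pr = px ∷ pl , pr

Bfuel-All≤ : ∀ k {n σ} → All (_≤ n) σ → All (_≤ n) (Bfuel k σ)
Bfuel-All≤ zero σ≤n = []
Bfuel-All≤ (suc k) {σ = []} σ≤n = []
Bfuel-All≤ (suc k) {σ = x ∷ xs} σ≤n
  with splitAt= (maxOf (x ∷ xs)) (x ∷ xs) | splitAt=-All (maxOf (x ∷ xs)) σ≤n
... | σ₁ , σ₂ | σ₁≤n , σ₂≤n = All.++⁺ (Bfuel-All≤ k σ₁≤n) (All.∷ʳ⁺ σ₂≤n (maxOf-least σ≤n))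

Bfuel-∷ʳ-maxOf : ∀ k x xs → let M = maxOf (x ∷ xs) in
  ∃ λ ρ → Bfuel (suc k) (x ∷ xs) ≡ ρ ∷ʳ M × All (_≤ M) ρ
Bfuel-∷ʳ-maxOf k x xs
  with splitAt= (maxOf (x ∷ xs)) (x ∷ xs) | splitAt=-All (maxOf (x ∷ xs)) (maxOf-upper (x ∷ xs))
... | σ₁ , σ₂ | σ₁≤ , σ₂≤ =
  Bfuel k σ₁ ++ σ₂ , sym (++-assoc (Bfuel k σ₁) σ₂ _) , All.++⁺ (Bfuel-All≤ k σ₁≤) σ₂≤

B-∷ʳ-max : ∀ {σ} → IsPerm (B σ) → ∃₂ λ ρ M → B σ ≡ ρ ∷ʳ M × All (_< M) ρ
B-∷ʳ-max {[]} (B≢[] , _) = contradiction refl B≢[]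
B-∷ʳ-max {x ∷ xs} perm with Bfuel-∷ʳ-maxOf (length xs) x xs
... | ρ , B≡ρM , ρ≤M =
  ρ , _ , B≡ρM , All.zipWith (λ (y≤M , M≢y) → ≤∧≢⇒< y≤M (M≢y ∘ sym)) (ρ≤M , All.¬Any⇒All¬ ρ M∉ρ)
  where
  M∉ρ : maxOf (x ∷ xs) ∉ ρ
  M∉ρ = ∉-Unique-++ ρ (subst Unique B≡ρM (IsPerm⇒Unique perm))

B⁻¹Av-∷ʳ : ∀ {π z c} → All (_< c) (π ∷ʳ z) → ¬ All (_< z) π → ∀ σ →
  Av (π ∷ʳ z ∷ʳ c) (B σ) ⇔ Av (π ∷ʳ z) (B σ)
B⁻¹Av-∷ʳ {π} {z} {c} πz<c π≮z σ = Av-cong {B σ} {π ∷ʳ z ∷ʳ c} {π ∷ʳ z} Contains-B⇔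
  where
  Contains-B⇔ : IsPerm (B σ) → Contains (B σ) (π ∷ʳ z ∷ʳ c) ⇔ Contains (B σ) (π ∷ʳ z)
  Contains-B⇔ perm with B-∷ʳ-max {σ} perm
  ... | ρ , M , B≡ρM , ρ<M rewrite B≡ρM = Contains-∷ʳ-max⇔ ρ<M πz<c π≮z

corollary2p11 : (a b c : ℕ) (α β : List ℕ) →
    IsPerm (a ∷ α ++ b ∷ β ++ [ c ]) →
    lrmax (a ∷ α ++ b ∷ β ++ [ c ]) ≡ a ∷ b ∷ c ∷ [] →
    ¬ (β ≡ []) →
    (π′ : List ℕ) → IsPerm π′ → OrderIso π′ (a ∷ α ++ b ∷ β) →
    (σ : List ℕ) → Unique σ →
    Av (a ∷ α ++ b ∷ β ++ [ c ]) (B σ) ⇔ Av π′ (B σ)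
corollary2p11 a b c α β π-perm π-lrmax β≢[] π′ _ π′≅ σ _ with initLast β
... | [] = contradiction refl β≢[]
-- Reassociate so that the permutation reads (π₀ ∷ʳ z) ∷ʳ c and π′'s pattern reads π₀ ∷ʳ z.
... | β₀ ∷ʳ′ z rewrite sym (++-assoc α (b ∷ β₀ ∷ʳ z) [ c ]) | sym (++-assoc α (b ∷ β₀) [ z ]) =
  ⇔.trans (B⁻¹Av-∷ʳ π₀z<c π₀≮z σ) (Av-resp-≃ (≃-sym (OrderIso⇒≃ π′ (π₀ ∷ʳ z) π′≅)))
  where
  π₀ : List ℕ
  π₀ = a ∷ α ++ b ∷ β₀
  π₀z<c : All (_< c) (π₀ ∷ʳ z)
  π₀z<c = ∈-lrmax⇒All< (π₀ ∷ʳ z) [] (∉-Unique-++ (π₀ ∷ʳ z) (IsPerm⇒Unique π-perm))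
            (subst (c ∈_) (sym π-lrmax) (there (there (here refl))))
  π₀≮z : ¬ All (_< z) π₀
  π₀≮z π₀<z with subst (z ∈_) π-lrmax
                   (subst (λ l → z ∈ lrmax l) (sym (++-assoc π₀ [ z ] [ c ])) (All<⇒∈-lrmax π₀ [ c ] π₀<z))
  ... | here z≡a = <-irrefl (sym z≡a) (All.head π₀<z)
  ... | there (here z≡b) = <-irrefl (sym z≡b) (All.lookup π₀<z (there (∈-++⁺ʳ α (here refl))))
  ... | there (there (here z≡c)) = <-irrefl z≡c (All.lookup π₀z<c (∈-++⁺ʳ π₀ (here refl)))
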